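{- Let $R=\{r_n:n\in\mathbb{N}\}$ be a countably infinite set with a fixed enumeration and with magnum $\theta\in\mathbf{Nn}$, and let $A\subseteq R$. (a) If $\Lambda_1$ and $\Lambda_2$ are partition functions both determining fenestrations of $R$, then the values $\widehat{K^{1}_A}(\hat\Lambda_1^{ -1}(\theta))$ and $\widehat{K^{2}_A}(\hat\Lambda_2^{ -1}(\theta))$ computed with respect to them coincide; that is, $m(A|R)$ is independent of the fenestration of $R$. (b) If the elements of $A$ are listed in a different order (giving $\tilde A$), then $m(\tilde A|R)=m(A|R)$.
   Context: Conway's surreal numbers form an ordered field; $\omega=\{0,1,2,\dots\mid\ \}$ is the first infinite surreal number. An omnific integer is a surreal number $x$ with $x=\{x-1\mid x+1\}$; the surnatural numbers $\mathbf{Nn}$ are the omnific integers $\ge 0$. $\mathbb{N}=\{1,2,\dots\}\subseteq\mathbf{Nn}$, $\mathbb{N}_0=\mathbb{N}\cup\{0\}$. Axiom of Extension (assumed throughout): every nondecreasing function $f:\mathbb{N}\to\mathbb{N}_0$ has an extension $\hat f:\mathbf{Nn}\to\mathbf{Nn}$ agreeing with $f$ on $\mathbb{N}$, such that for nondecreasing $f,g$: if $f(n)=g(n)$ for all sufficiently large $n$ then $\hat f(\nu)=\hat g(\nu)$ for all $\nu\in\mathbf{Nn}\setminus\mathbb{N}$; if $f(n)<g(n)$ for all sufficiently large $n$ then $\hat f(\nu)<\hat g(\nu)$ for all $\nu\in\mathbf{Nn}\setminus\mathbb{N}$; and $\widehat{f+g}=\hat f+\hat g$, $\widehat{f\cdot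 g}=\hat f\cdot\hat g$, $\widehat{f\circ g}=\hat f\circ\hat g$ (where defined). A partition function is a strictly increasing $\Lambda:\mathbb{N}\to\mathbb{N}$, with $\Lambda(0)=0$; it determines the partition $R=\biguplus_n R_n$, $R_n=\{r_k:\Lambda(n-1)<k\le\Lambda(n)\}$. This partition is a fenestration of $R$ (whose magnum is $\theta$) if there exists $\nu\in\mathbf{Nn}$ with $\hat\Lambda(\nu)=\theta$; then $\hat\Lambda^{ -1}(\theta)$ denotes this $\nu$. For $A\subseteq R$ set $X_A(n)=|A\cap R_n|$ and $K_A(n)=\sum_{k=1}^n X_A(k)$ (superscripts $1,2$ indicate computation with $\Lambda_1,\Lambda_2$). The magnum of $A$ relative to $R$ is $m(A|R):=\widehat{K_A}(\hat\Lambda^{ -1}(\theta))$. -}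

module Defs where

open import Data.Nat using (ℕ; zero; suc; _+_; _*_; _∸_; _≤_; _<_; _<ᵇ_)
open import Data.Bool using (Bool; true; false; _∧_; if_then_else_)
open import Data.Product using (Σ; _×_; _,_)
open import Function using (_∘_)
open import Relation.Binary.PropositionalEquality using (_≡_)
open import Relation.Nullary using (¬_)

-- Functions ℕ → ℕ₀.  Agda's ℕ contains 0; the paper's domain ℕ = {1,2,…}
-- is rendered by only ever constraining arguments n with 1 ≤ n.

Nondecreasing : (ℕ → ℕ) → Set
Nondecreasing f = ∀ m n → 1 ≤ m → m ≤ n → f m ≤ f n

EventuallyEq : (ℕ → ℕ) → (ℕ → ℕ) → Set
EventuallyEq f g = Σ ℕ λ N → ∀ n → N ≤ n → f n ≡ g n

EventuallyLt : (ℕ → ℕ) → (ℕ → ℕ) → Set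
EventuallyLt f g = Σ ℕ λ N → ∀ n → N ≤ n → f n < g n

-- Surreal numbers are not available in Agda; we quantify over any
-- structure (Nn, embedding of ℕ₀, +, ·, <) equipped with an extension
-- operator satisfying the Axiom of Extension.

record ExtensionModel : Set₁ where
  field
    Nn   : Set
    ι    : ℕ → Nn
    _⊕_  : Nn → Nn → Nn
    _⊗_  : Nn → Nn → Nn
    _≺_  : Nn → Nn → Set

  -- ν ∈ Nn ∖ ℕ  (note ℕ = {1,2,...}, so 0 ∈ Nn ∖ ℕ as in the paper)
  NotInℕ : Nn → Set
  NotInℕ ν = ∀ n → 1 ≤ n → ¬ (ν ≡ ι n)

  field
    -- the extension f ↦ f̂ (only its values on nondecreasing f matter)
    hat      : (ℕ → ℕ) → Nn → Nn
    hat-ext  : ∀ f → Nondecreasing f → ∀ n → 1 ≤ n → hat f (ι n) ≡ ι (f n)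
    hat-eq   : ∀ f g → Nondecreasing f → Nondecreasing g → EventuallyEq f g →
               ∀ ν → NotInℕ ν → hat f ν ≡ hat g ν
    hat-lt   : ∀ f g → Nondecreasing f → Nondecreasing g → EventuallyLt f g →
               ∀ ν → NotInℕ ν → hat f ν ≺ hat g ν
    hat-+    : ∀ f g → Nondecreasing f → Nondecreasing g →
               ∀ ν → hat (λ n → f n + g n) ν ≡ (hat f ν ⊕ hat g ν)
    hat-*    : ∀ f g → Nondecreasing f → Nondecreasing g →
               ∀ ν → hat (λ n → f n * g n) ν ≡ (hat f ν ⊗ hat g ν)
    -- f ∘ g is defined when g takes values in ℕ = {1,2,...}
    hat-∘    : ∀ f g → Nondecreasing f → Nondecreasing g →
               (∀ n → 1 ≤ n → 1 ≤ g n) →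
               ∀ ν → hat (f ∘ g) ν ≡ hat f (hat g ν)
    -- f̂ depends only on the function f : ℕ → ℕ₀ (on {1,2,...}); classically
    -- a consequence of hat-ext and hat-eq, needed since Agda lacks funext
    -- and cannot decide ν ∈ ℕ.
    hat-cong : ∀ f g → Nondecreasing f → (∀ n → 1 ≤ n → f n ≡ g n) →
               ∀ ν → hat f ν ≡ hat g ν

record PartitionFunction : Set where
  field
    Λ        : ℕ → ℕ
    Λ-zero   : Λ 0 ≡ 0
    Λ-strict : ∀ m n → m < n → Λ m < Λ n

-- R = {r_k : k ≥ 1} with its fixed enumeration; a subset A ⊆ R is given
-- by its characteristic function χ on indices k (χ k = true iff r_k ∈ A).

countIn : (ℕ → Bool) → ℕ → ℕ → ℕ
countIn χ lo zero    = 0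
countIn χ lo (suc h) =
  countIn χ lo h + (if (lo <ᵇ suc h) ∧ χ (suc h) then 1 else 0)

X : (ℕ → Bool) → PartitionFunction → ℕ → ℕ
X χ P n = countIn χ (Λ (n ∸ 1)) (Λ n)
  where open PartitionFunction P

K : (ℕ → Bool) → PartitionFunction → ℕ → ℕ
K χ P zero    = 0
K χ P (suc n) = K χ P n + X χ P (suc n)

IsFenestrationWitness : (M : ExtensionModel) → PartitionFunction →
                        ExtensionModel.Nn M → ExtensionModel.Nn M → Set
IsFenestrationWitness M P θ ν = hat (PartitionFunction.Λ P) ν ≡ θ
  where open ExtensionModel M

-- m(A|R) computed with fenestration P and witness ν = Λ̂⁻¹(θ)
magnum : (M : ExtensionModel) → (ℕ → Bool) → PartitionFunction →
         ExtensionModel.Nn M → ExtensionModel.Nn M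
magnum M χ P ν = ExtensionModel.hat M (K χ P) ν

Lists : {I : Set} → (I → ℕ) → (ℕ → Bool) → Set
Lists {I} e χ = ∀ k → (χ k ≡ true → Σ I λ i → e i ≡ k) × (Σ I (λ i → e i ≡ k) → χ k ≡ true)

{-# OPTIONS --safe #-}
module Submission where

-- Let C_A(h) = count χ h be the number of indices k ≤ h with r_k ∈ A.  Whatever
-- the partition function, K_A = C_A ∘ Λ, because K_A(n) counts A in the first n
-- windows, i.e. among r_1, …, r_Λ(n).  Hence, by the composition rule of the
-- Axiom of Extension, m(A|R) = Ĉ_A(Λ̂(Λ̂⁻¹(θ))) = Ĉ_A(θ), which mentions no
-- fenestration.  Relisting A does not change its characteristic function,
-- so it does not change K_A either.

open import Defs
open import Data.Nat using (ℕ; zero; suc; _+_; _≤_; _<_; _<ᵇ_; _≤′_; ≤′-refl; ≤′-step; s≤s)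
open import Data.Nat.Properties
open import Data.Bool using (Bool; true; false; _∧_; if_then_else_)
open import Data.Bool.Properties using (T-≡; ¬-not; ⇔→≡)
open import Data.Sum using (inj₁; inj₂)
open import Data.Product using (_×_; _,_; proj₁; proj₂)
open import Function using (_∘_)
open import Function.Bundles using (Inverse; _↔_; Equivalence; mk⇔; Surjection)
open import Function.Properties.Inverse using (↔⇒↠)
open import Function.Definitions using (StrictlySurjective)
open import Relation.Binary.PropositionalEquality
open ≡-Reasoning

<ᵇ≡true : ∀ {m n} → m < n → (m <ᵇ n) ≡ true
<ᵇ≡true m<n = Equivalence.to T-≡ (<⇒<ᵇ m<n)

<ᵇ≡false : ∀ m n → n ≤ m → (m <ᵇ n) ≡ false
<ᵇ≡false m n n≤m = ¬-not λ m<ᵇn → <⇒≱ (<ᵇ⇒< m n (Equivalence.from T-≡ m<ᵇn)) n≤m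

count : (ℕ → Bool) → ℕ → ℕ
count χ = countIn χ 0

countIn-empty : ∀ χ lo h → h ≤ lo → countIn χ lo h ≡ 0
countIn-empty χ lo zero    _ = refl
countIn-empty χ lo (suc h) h<lo rewrite <ᵇ≡false lo (suc h) h<lo =
  trans (+-identityʳ _) (countIn-empty χ lo h (<⇒≤ h<lo))

count-split : ∀ χ {lo hi} → lo ≤′ hi → count χ hi ≡ count χ lo + countIn χ lo hi
count-split χ {lo} ≤′-refl = begin
  count χ lo                    ≡⟨ +-identityʳ _ ⟨
  count χ lo + 0                ≡⟨ cong (count χ lo +_) (countIn-empty χ lo lo ≤-refl) ⟨
  count χ lo + countIn χ lo lo  ∎
count-split χ {lo} (≤′-step {n = h} lo≤h)
  rewrite <ᵇ≡true {lo} {suc h} (s≤s (≤′⇒≤ lo≤h)) = begin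
  count χ h + b                        ≡⟨ cong (_+ b) (count-split χ lo≤h) ⟩
  count χ lo + countIn χ lo h + b      ≡⟨ +-assoc (count χ lo) _ b ⟩
  count χ lo + (countIn χ lo h + b)    ∎
  where
  b : ℕ
  b = if χ (suc h) then 1 else 0

count-mono : ∀ χ {m n} → m ≤ n → count χ m ≤ count χ n
count-mono χ m≤n = subst (_ ≤_) (sym (count-split χ (≤⇒≤′ m≤n))) (m≤m+n _ _)

countIn-cong : ∀ {χ χ′} → χ ≗ χ′ → ∀ lo h → countIn χ lo h ≡ countIn χ′ lo h
countIn-cong χ≗χ′ lo zero    = refl
countIn-cong χ≗χ′ lo (suc h) =
  cong₂ (λ c b → c + (if (lo <ᵇ suc h) ∧ b then 1 else 0)) (countIn-cong χ≗χ′ lo h) (χ≗χ′ (suc h))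

module _ (P : PartitionFunction) where
  open PartitionFunction P

  Λ-mono : ∀ {m n} → m ≤ n → Λ m ≤ Λ n
  Λ-mono {m} {n} m≤n with m≤n⇒m<n∨m≡n m≤n
  ... | inj₁ m<n  = <⇒≤ (Λ-strict m n m<n)
  ... | inj₂ refl = ≤-refl

  Λ-positive : ∀ n → 1 ≤ n → 1 ≤ Λ n
  Λ-positive n 1≤n = subst (_< Λ n) Λ-zero (Λ-strict 0 n 1≤n)

  K≡count∘Λ : ∀ χ n → K χ P n ≡ count χ (Λ n)
  K≡count∘Λ χ zero    = sym (cong (count χ) Λ-zero)
  K≡count∘Λ χ (suc n) = begin
    K χ P n + X χ P (suc n)                      ≡⟨ cong (_+ X χ P (suc n)) (K≡count∘Λ χ n) ⟩
    count χ (Λ n) + countIn χ (Λ n) (Λ (suc n))  ≡⟨ count-split χ (≤⇒≤′ (<⇒≤ (Λ-strict n (suc n) (n<1+n n)))) ⟨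
    count χ (Λ (suc n))                          ∎

  K-nondecreasing : ∀ χ → Nondecreasing (K χ P)
  K-nondecreasing χ m n _ m≤n =
    subst₂ _≤_ (sym (K≡count∘Λ χ m)) (sym (K≡count∘Λ χ n)) (count-mono χ (Λ-mono m≤n))

  K-cong : ∀ {χ χ′} → χ ≗ χ′ → ∀ n → K χ P n ≡ K χ′ P n
  K-cong χ≗χ′ zero    = refl
  K-cong χ≗χ′ (suc n) = cong₂ _+_ (K-cong χ≗χ′ n) (countIn-cong χ≗χ′ (Λ n) (Λ (suc n)))

module _ (M : ExtensionModel) where
  open ExtensionModel M

  magnum≡hat-count : ∀ χ P θ ν → IsFenestrationWitness M P θ ν → magnum M χ P ν ≡ hat (count χ) θ
  magnum≡hat-count χ P θ ν Λ̂ν≡θ = begin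
    hat (K χ P) ν                                  ≡⟨ hat-cong _ _ (K-nondecreasing P χ) (λ n _ → K≡count∘Λ P χ n) ν ⟩
    hat (count χ ∘ PartitionFunction.Λ P) ν        ≡⟨ hat-∘ _ _ (λ _ _ _ → count-mono χ) (λ _ _ _ → Λ-mono P) (Λ-positive P) ν ⟩
    hat (count χ) (hat (PartitionFunction.Λ P) ν)  ≡⟨ cong (hat (count χ)) Λ̂ν≡θ ⟩
    hat (count χ) θ                                ∎

  magnum-cong : ∀ {χ χ′} P ν → χ ≗ χ′ → magnum M χ P ν ≡ magnum M χ′ P ν
  magnum-cong {χ} P ν χ≗χ′ = hat-cong _ _ (K-nondecreasing P χ) (λ n _ → K-cong P χ≗χ′ n) ν

Lists-unique : ∀ {I : Set} {e : I → ℕ} {χ χ′} → Lists e χ → Lists e χ′ → χ ≗ χ′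
Lists-unique L L′ k = ⇔→≡ (mk⇔ (proj₂ (L′ k) ∘ proj₁ (L k)) (proj₂ (L k) ∘ proj₁ (L′ k)))

Lists-∘-surjective : ∀ {I J : Set} {e : I → ℕ} {f : J → I} {χ} →
                     StrictlySurjective _≡_ f → Lists (e ∘ f) χ → Lists e χ
Lists-∘-surjective {e = e} {f} f-onto L k =
    (λ χk → let (j , efj≡k) = proj₁ (L k) χk in f j , efj≡k)
  , (λ { (i , ei≡k) → let (j , fj≡i) = f-onto i in proj₂ (L k) (j , trans (cong e fj≡i) ei≡k) })

theorem18 : (M : ExtensionModel) → (θ : ExtensionModel.Nn M) →
    -- (a) independence of the fenestration
    (∀ (χ : ℕ → Bool) (P₁ P₂ : PartitionFunction) (ν₁ ν₂ : ExtensionModel.Nn M) →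
      IsFenestrationWitness M P₁ θ ν₁ → IsFenestrationWitness M P₂ θ ν₂ →
      magnum M χ P₁ ν₁ ≡ magnum M χ P₂ ν₂)
    ×
    -- (b) independence of the order in which A is listed
    (∀ (I : Set) (e : I → ℕ) (σ : I ↔ I) (χ χ̃ : ℕ → Bool) →
      Lists e χ → Lists (e ∘ Inverse.to σ) χ̃ →
      ∀ (P : PartitionFunction) (ν : ExtensionModel.Nn M) →
      IsFenestrationWitness M P θ ν →
      magnum M χ̃ P ν ≡ magnum M χ P ν)
theorem18 M θ =
    (λ χ P₁ P₂ ν₁ ν₂ w₁ w₂ → trans (magnum≡hat-count M χ P₁ θ ν₁ w₁) (sym (magnum≡hat-count M χ P₂ θ ν₂ w₂)))
  , (λ I e σ χ χ̃ L L̃ P ν _ → magnum-cong M P ν (Lists-unique (Lists-∘-surjective (Surjection.strictlySurjective (↔⇒↠ σ)) L̃) L))
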